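{- For every $\mu$ with $0<\mu\le 1/100$ there exists $d_0>0$ such that for all $d$ with $0<d\le d_0$ and all $\tau$ with $\mu\le\tau\le 1/100$ the following holds: if $R$ is a digraph with $\delta^0(R)\ge (3/8-3d)|R|$ which is a robust $(\mu,1/3)$-outexpander, then $R$ is also a robust $(\mu,\tau)$-outexpander.
   Context: For $0<\mu\le\tau<1$, a digraph $R$ is a robust $(\mu,\tau)$-outexpander if $|N_R^+(S)|\ge |S|+\mu|R|$ for every $S\subseteq V(R)$ with $\tau|R|\le |S|\le (1-\tau)|R|$, where $N_R^+(S)$ is the union of the out-neighbourhoods of the vertices of $S$. $\delta^0(R)$ is the minimum over all vertices of their out-degrees and in-degrees, and $|R|$ is the number of vertices of $R$. (The paper states the hypothesis on the parameters as $d\ll\mu\le\tau\le 1/100$, meaning $d$ is sufficiently small relative to $\mu$.)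
   Formalization: The parameters μ, d and τ range over the rationals, and the constant d₀ is taken in the rationals. -}

module Defs where

open import Data.Bool using (Bool; true; false; _∧_; _∨_)
open import Data.Nat using (ℕ)
open import Data.Integer using (+_)
open import Data.Fin using (Fin)
open import Data.Fin.Subset using (Subset; _∈_; _∉_; ∣_∣)
open import Data.Vec using (tabulate; lookup; foldr′)
open import Data.Rational using (ℚ; _/_; _≤_; _+_; _*_; _-_; 1ℚ)
open import Data.Product using (_×_)

record Digraph (n : ℕ) : Set where
  field
    out      : Fin n → Subset n
    loopless : ∀ i → i ∉ out i
open Digraph public

ℕ→ℚ : ℕ → ℚ
ℕ→ℚ m = (+ m) / 1

∣V∣ : ∀ {n} → Digraph n → ℕ
∣V∣ {n} _ = n

outdeg : ∀ {n} → Digraph n → Fin n → ℕ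
outdeg R i = ∣ out R i ∣

indeg : ∀ {n} → Digraph n → Fin n → ℕ
indeg R j = ∣ tabulate (λ i → lookup (out R i) j) ∣

δ⁰≥ : ∀ {n} → Digraph n → ℚ → Set
δ⁰≥ R k = ∀ i → (k ≤ ℕ→ℚ (outdeg R i)) × (k ≤ ℕ→ℚ (indeg R i))

N⁺ : ∀ {n} → Digraph n → Subset n → Subset n
N⁺ R S = tabulate (λ j → foldr′ _∨_ false (tabulate (λ i → lookup S i ∧ lookup (out R i) j)))

RobustOutexpander : ∀ {n} → Digraph n → ℚ → ℚ → Set
RobustOutexpander {n} R μ τ =
  ∀ (S : Subset n) →
    τ * ℕ→ℚ n ≤ ℕ→ℚ (∣ S ∣) →
    ℕ→ℚ (∣ S ∣) ≤ (1ℚ - τ) * ℕ→ℚ n →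
    ℕ→ℚ (∣ S ∣) + μ * ℕ→ℚ n ≤ ℕ→ℚ (∣ N⁺ R S ∣)

-- Expansion is only at stake for sets of size below n/3 or above 2n/3.  A
-- nonempty small set S has |N⁺(S)| ≥ δ⁰ ≥ (1/3 + μ)n > |S| + μn.  A large set
-- S is met by the in-neighbourhood of every vertex, because δ⁰ + |S| > n, so
-- N⁺(S) is everything and |S| + μn ≤ (1 - τ)n + τn = n.
module Submission where

open import Defs
open import Data.Nat using (ℕ)
open import Data.Integer using (+_)
open import Data.Rational using (ℚ; _/_; _≤_; _<_; _*_; _-_; 0ℚ)
open import Data.Product using (Σ; _×_)

open import Data.Bool using (Bool; true; false; _∧_; _∨_)
open import Data.Bool.Properties using (∨-zeroʳ)
open import Data.Empty using (⊥-elim)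
open import Data.Fin using (Fin; zero; suc)
open import Data.Fin.Subset using (Subset; _∈_; _∉_; ∣_∣; ∁; ⊤; _⊆_; Empty)
open import Data.Fin.Subset.Properties
  using (_∈?_; x∉p⇒x∈∁p; p⊆q⇒∣p∣≤∣q∣; ∣∁p∣≡n∸∣p∣; ∣⊤∣≡n; ∣p∣≤n; nonempty?; Empty-unique; ∣⊥∣≡0)
import Data.Integer as ℤ
import Data.Integer.Properties as ℤ
import Data.Nat as ℕ
import Data.Nat.Coprimality as Coprimality
import Data.Nat.Properties as ℕ
open import Data.Product using (_,_; proj₁; proj₂)
open import Data.Rational using (mkℚ; *≤*; _+_; 1ℚ; _≤?_; _<?_; nonNegative)
open import Data.Rational.Properties
open import Data.Rational.Solver using (module +-*-Solver)
open import Data.Unit using (tt)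
open import Data.Vec using (Vec; _∷_; lookup; tabulate; foldr′)
open import Data.Vec.Properties using (lookup∘tabulate; []=⇒lookup; lookup⇒[]=)
open import Relation.Binary.PropositionalEquality
open import Relation.Nullary using (yes; no)
open import Relation.Nullary.Decidable using (toWitness)

ℕ→ℚ≡mkℚ : ∀ m → ℕ→ℚ m ≡ mkℚ (+ m) 0 (Coprimality.sym (Coprimality.1-coprimeTo m))
ℕ→ℚ≡mkℚ m = normalize-coprime (Coprimality.sym (Coprimality.1-coprimeTo m))

ℕ→ℚ-mono-≤ : ∀ {m n} → m ℕ.≤ n → ℕ→ℚ m ≤ ℕ→ℚ n
ℕ→ℚ-mono-≤ {m} {n} m≤n rewrite ℕ→ℚ≡mkℚ m | ℕ→ℚ≡mkℚ n =
  *≤* (subst₂ ℤ._≤_ (sym (ℤ.*-identityʳ (+ m))) (sym (ℤ.*-identityʳ (+ n))) (ℤ.+≤+ m≤n))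

ℕ→ℚ-cancel-< : ∀ {m n} → ℕ→ℚ m < ℕ→ℚ n → m ℕ.< n
ℕ→ℚ-cancel-< {m} {n} m<n = ℕ.≰⇒> (λ n≤m → <-irrefl refl (<-≤-trans m<n (ℕ→ℚ-mono-≤ n≤m)))

-- On the normal forms mkℚ (+ m) 0 _, _+_ computes to the middle expression.
ℕ→ℚ-homo-+ : ∀ m n → ℕ→ℚ (m ℕ.+ n) ≡ ℕ→ℚ m + ℕ→ℚ n
ℕ→ℚ-homo-+ m n = begin
  + (m ℕ.+ n) / 1                    ≡⟨ cong (_/ 1) (cong₂ ℤ._+_ (sym (ℤ.*-identityʳ (+ m))) (sym (ℤ.*-identityʳ (+ n)))) ⟩
  (+ m ℤ.* + 1 ℤ.+ + n ℤ.* + 1) / 1  ≡⟨ cong₂ _+_ (ℕ→ℚ≡mkℚ m) (ℕ→ℚ≡mkℚ n) ⟨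
  ℕ→ℚ m + ℕ→ℚ n                      ∎
  where open ≡-Reasoning

0≤ℕ→ℚ : ∀ n → 0ℚ ≤ ℕ→ℚ n
0≤ℕ→ℚ n = ℕ→ℚ-mono-≤ (ℕ.z≤n {n})

*-monoʳ-≤-ℕ→ℚ : ∀ m {p q} → p ≤ q → p * ℕ→ℚ m ≤ q * ℕ→ℚ m
*-monoʳ-≤-ℕ→ℚ m = *-monoʳ-≤-nonNeg (ℕ→ℚ m) {{nonNegative (0≤ℕ→ℚ m)}}

1-p*r+p*r≡r : ∀ p r → (1ℚ - p) * r + p * r ≡ r
1-p*r+p*r≡r = solve 2 (λ p r → (con 1ℚ :- p) :* r :+ p :* r := r) refl
  where open +-*-Solver

or≡true : ∀ {m} (v : Vec Bool m) k → lookup v k ≡ true → foldr′ _∨_ false v ≡ true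
or≡true (x ∷ v) zero    refl = refl
or≡true (x ∷ v) (suc k) vₖ≡true rewrite or≡true v k vₖ≡true = ∨-zeroʳ x

inNeighbours : ∀ {n} → Digraph n → Fin n → Subset n
inNeighbours R j = tabulate (λ i → lookup (out R i) j)

module _ {n} (R : Digraph n) where

  ∈-N⁺ : ∀ {S i j} → i ∈ S → j ∈ out R i → j ∈ N⁺ R S
  ∈-N⁺ {S} {i} {j} i∈S j∈outᵢ = lookup⇒[]= j (N⁺ R S)
    (trans (lookup∘tabulate _ j) (or≡true row i row[i]≡true))
    where
    row : Subset n
    row = tabulate (λ k → lookup S k ∧ lookup (out R k) j)
    row[i]≡true : lookup row i ≡ true
    row[i]≡true = trans (lookup∘tabulate _ i) (cong₂ _∧_ ([]=⇒lookup i∈S) ([]=⇒lookup j∈outᵢ))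

  outdeg≤∣N⁺∣ : ∀ {S i} → i ∈ S → outdeg R i ℕ.≤ ∣ N⁺ R S ∣
  outdeg≤∣N⁺∣ {S} i∈S = p⊆q⇒∣p∣≤∣q∣ (∈-N⁺ {S} i∈S)

  indeg+∣S∣≤n : ∀ {S j} → j ∉ N⁺ R S → indeg R j ℕ.+ ∣ S ∣ ℕ.≤ n
  indeg+∣S∣≤n {S} {j} j∉N⁺ = ℕ.m≤o∸n⇒m+n≤o (indeg R j) (∣p∣≤n S)
    (ℕ.≤-trans (p⊆q⇒∣p∣≤∣q∣ inNeighbours⊆∁S) (ℕ.≤-reflexive (∣∁p∣≡n∸∣p∣ S)))
    where
    inNeighbours⊆∁S : inNeighbours R j ⊆ ∁ S
    inNeighbours⊆∁S {i} i∈in = x∉p⇒x∈∁p λ i∈S →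
      j∉N⁺ (∈-N⁺ {S} i∈S (lookup⇒[]= j (out R i) (trans (sym (lookup∘tabulate _ i)) ([]=⇒lookup i∈in))))

  ∣N⁺∣≡n : ∀ {S} → (∀ j → n ℕ.< indeg R j ℕ.+ ∣ S ∣) → ∣ N⁺ R S ∣ ≡ n
  ∣N⁺∣≡n {S} n<indeg+∣S∣ = ℕ.≤-antisym (∣p∣≤n (N⁺ R S))
    (subst (ℕ._≤ ∣ N⁺ R S ∣) (∣⊤∣≡n n) (p⊆q⇒∣p∣≤∣q∣ ⊤⊆N⁺))
    where
    ⊤⊆N⁺ : ⊤ ⊆ N⁺ R S
    ⊤⊆N⁺ {j} _ with j ∈? N⁺ R S
    ... | yes j∈N⁺ = j∈N⁺
    ... | no  j∉N⁺ = ⊥-elim (ℕ.<⇒≱ (n<indeg+∣S∣ j) (indeg+∣S∣≤n {S} j∉N⁺))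

  open ≤-Reasoning

  expands-small : ∀ {μ a c S i} → i ∈ S → a + μ ≤ c → δ⁰≥ R (c * ℕ→ℚ n) →
    ℕ→ℚ (∣ S ∣) ≤ a * ℕ→ℚ n → ℕ→ℚ (∣ S ∣) + μ * ℕ→ℚ n ≤ ℕ→ℚ (∣ N⁺ R S ∣)
  expands-small {μ} {a} {c} {S} {i} i∈S a+μ≤c δ⁰ s≤an = begin
    ℕ→ℚ (∣ S ∣) + μ * ℕ→ℚ n  ≤⟨ +-monoˡ-≤ (μ * ℕ→ℚ n) s≤an ⟩
    a * ℕ→ℚ n + μ * ℕ→ℚ n    ≡⟨ *-distribʳ-+ (ℕ→ℚ n) a μ ⟨
    (a + μ) * ℕ→ℚ n          ≤⟨ *-monoʳ-≤-ℕ→ℚ n a+μ≤c ⟩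
    c * ℕ→ℚ n                ≤⟨ proj₁ (δ⁰ i) ⟩
    ℕ→ℚ (outdeg R i)         ≤⟨ ℕ→ℚ-mono-≤ (outdeg≤∣N⁺∣ {S} i∈S) ⟩
    ℕ→ℚ (∣ N⁺ R S ∣)         ∎

  expands-empty : ∀ {μ τ S} → Empty S → μ ≤ τ → τ * ℕ→ℚ n ≤ ℕ→ℚ (∣ S ∣) →
    ℕ→ℚ (∣ S ∣) + μ * ℕ→ℚ n ≤ ℕ→ℚ (∣ N⁺ R S ∣)
  expands-empty {μ} {τ} {S} empty μ≤τ τn≤s = begin
    ℕ→ℚ (∣ S ∣) + μ * ℕ→ℚ n    ≤⟨ +-monoʳ-≤ (ℕ→ℚ (∣ S ∣)) (≤-trans (*-monoʳ-≤-ℕ→ℚ n μ≤τ) τn≤s) ⟩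
    ℕ→ℚ (∣ S ∣) + ℕ→ℚ (∣ S ∣)  ≡⟨ cong₂ _+_ s≡0 s≡0 ⟩
    0ℚ + 0ℚ                    ≡⟨ +-identityˡ 0ℚ ⟩
    0ℚ                         ≤⟨ 0≤ℕ→ℚ (∣ N⁺ R S ∣) ⟩
    ℕ→ℚ (∣ N⁺ R S ∣)           ∎
    where
    s≡0 : ℕ→ℚ (∣ S ∣) ≡ 0ℚ
    s≡0 = cong ℕ→ℚ (trans (cong ∣_∣ (Empty-unique empty)) (∣⊥∣≡0 n))

  expands-large : ∀ {μ τ a c S} → a ≤ c → μ ≤ τ → δ⁰≥ R (c * ℕ→ℚ n) →
    (1ℚ - a) * ℕ→ℚ n < ℕ→ℚ (∣ S ∣) → ℕ→ℚ (∣ S ∣) ≤ (1ℚ - τ) * ℕ→ℚ n →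
    ℕ→ℚ (∣ S ∣) + μ * ℕ→ℚ n ≤ ℕ→ℚ (∣ N⁺ R S ∣)
  expands-large {μ} {τ} {a} {c} {S} a≤c μ≤τ δ⁰ [1-a]n<s s≤[1-τ]n = begin
    ℕ→ℚ (∣ S ∣) + μ * ℕ→ℚ n       ≤⟨ +-mono-≤ s≤[1-τ]n (*-monoʳ-≤-ℕ→ℚ n μ≤τ) ⟩
    (1ℚ - τ) * ℕ→ℚ n + τ * ℕ→ℚ n  ≡⟨ 1-p*r+p*r≡r τ (ℕ→ℚ n) ⟩
    ℕ→ℚ n                         ≡⟨ cong ℕ→ℚ (∣N⁺∣≡n {S} n<indeg+∣S∣) ⟨
    ℕ→ℚ (∣ N⁺ R S ∣)              ∎
    where
    n<indeg+∣S∣ : ∀ j → n ℕ.< indeg R j ℕ.+ ∣ S ∣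
    n<indeg+∣S∣ j = ℕ→ℚ-cancel-< (begin-strict
      ℕ→ℚ n                          ≡⟨ 1-p*r+p*r≡r a (ℕ→ℚ n) ⟨
      (1ℚ - a) * ℕ→ℚ n + a * ℕ→ℚ n   <⟨ +-mono-<-≤ [1-a]n<s (*-monoʳ-≤-ℕ→ℚ n a≤c) ⟩
      ℕ→ℚ (∣ S ∣) + c * ℕ→ℚ n        ≤⟨ +-monoʳ-≤ (ℕ→ℚ (∣ S ∣)) (proj₂ (δ⁰ j)) ⟩
      ℕ→ℚ (∣ S ∣) + ℕ→ℚ (indeg R j)  ≡⟨ +-comm (ℕ→ℚ (∣ S ∣)) (ℕ→ℚ (indeg R j)) ⟩
      ℕ→ℚ (indeg R j) + ℕ→ℚ (∣ S ∣)  ≡⟨ ℕ→ℚ-homo-+ (indeg R j) ∣ S ∣ ⟨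
      ℕ→ℚ (indeg R j ℕ.+ ∣ S ∣)      ∎)

  robustOutexpander-widen : ∀ {μ τ a c} → 0ℚ ≤ μ → μ ≤ τ → a + μ ≤ c →
    δ⁰≥ R (c * ℕ→ℚ n) → RobustOutexpander R μ a → RobustOutexpander R μ τ
  robustOutexpander-widen {a = a} {c} 0≤μ μ≤τ a+μ≤c δ⁰ expander S τn≤s s≤[1-τ]n
    with a * ℕ→ℚ n ≤? ℕ→ℚ (∣ S ∣) | ℕ→ℚ (∣ S ∣) ≤? (1ℚ - a) * ℕ→ℚ n | nonempty? S
  ... | yes an≤s | yes s≤[1-a]n | _             = expander S an≤s s≤[1-a]n
  ... | no  an≰s | _            | yes (i , i∈S) = expands-small {a = a} {S = S} i∈S a+μ≤c δ⁰ (<⇒≤ (≰⇒> an≰s))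
  ... | no  _    | _            | no  empty     = expands-empty {S = S} empty μ≤τ τn≤s
  ... | yes _    | no  s≰[1-a]n | _             = expands-large {S = S} a≤c μ≤τ δ⁰ (≰⇒> s≰[1-a]n) s≤[1-τ]n
    where
    a≤c : a ≤ c
    a≤c = ≤-trans (≤-trans (≤-reflexive (sym (+-identityʳ a))) (+-monoʳ-≤ a 0≤μ)) a+μ≤c

-- Any d₀ ≤ 19/1800 works: what is needed is 1/3 + 1/100 ≤ 3/8 - 3d₀.
d₀ : ℚ
d₀ = (+ 1) / 1000

0<d₀ : 0ℚ < d₀
0<d₀ = toWitness {a? = 0ℚ <? d₀} tt

⅓+μ≤⅜-3d : ∀ {μ d} → μ ≤ (+ 1) / 100 → d ≤ d₀ → (+ 1) / 3 + μ ≤ (+ 3) / 8 - (+ 3) / 1 * d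
⅓+μ≤⅜-3d {μ} {d} μ≤1/100 d≤d₀ = begin
  (+ 1) / 3 + μ              ≤⟨ +-monoʳ-≤ ((+ 1) / 3) μ≤1/100 ⟩
  (+ 1) / 3 + (+ 1) / 100    ≤⟨ toWitness {a? = (+ 1) / 3 + (+ 1) / 100 ≤? (+ 3) / 8 - (+ 3) / 1 * d₀} tt ⟩
  (+ 3) / 8 - (+ 3) / 1 * d₀ ≤⟨ +-monoʳ-≤ ((+ 3) / 8) (neg-antimono-≤ (*-monoˡ-≤-nonNeg ((+ 3) / 1) d≤d₀)) ⟩
  (+ 3) / 8 - (+ 3) / 1 * d  ∎
  where open ≤-Reasoning

fact3p1 : ∀ (μ : ℚ) → 0ℚ < μ → μ ≤ (+ 1) / 100 →
    Σ ℚ (λ d₀ → 0ℚ < d₀ ×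
      (∀ (d τ : ℚ) → 0ℚ < d → d ≤ d₀ → μ ≤ τ → τ ≤ (+ 1) / 100 →
        ∀ {n : ℕ} (R : Digraph n) →
          δ⁰≥ R (((+ 3) / 8 - (+ 3) / 1 * d) * ℕ→ℚ n) →
          RobustOutexpander R μ ((+ 1) / 3) →
          RobustOutexpander R μ τ))
fact3p1 μ 0<μ μ≤1/100 = d₀ , 0<d₀ , λ d τ _ d≤d₀ μ≤τ _ R δ⁰ expander →
  robustOutexpander-widen R {a = (+ 1) / 3} (<⇒≤ 0<μ) μ≤τ (⅓+μ≤⅜-3d μ≤1/100 d≤d₀) δ⁰ expander
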